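{- Let $q$ be an odd prime power and $m\ge2$ an integer with $m\mid q+1$. If $m\nmid\frac{q+1}{2}$, then $\alpha Q_0$ is a clique of size $\frac{q+1}{m}$ in $\mathrm{GP}(q^2,m)$; if $m\mid\frac{q+1}{2}$, then $\{0\}\cup\alpha Q_0$ is a clique of size $\frac{q+1+m}{m}$ in $\mathrm{GP}(q^2,m)$.
   Context: The generalised Paley graph $\mathrm{GP}(q^2,m)$ has vertex set $\mathbb{F}_{q^2}$, with two distinct vertices $x,y$ adjacent iff $x-y$ is an $m$-th power of an element of $\mathbb{F}_{q^2}^*$. Fix a non-square $d\in\mathbb{F}_q^*$ and $\alpha\in\mathbb{F}_{q^2}$ with $\alpha^2=d$. Fix a primitive element $\beta$ of $\mathbb{F}_{q^2}$, let $\omega=\beta^{q-1}$, $Q_0=\langle\omega^m\rangle$, and $\alpha Q_0=\{\alpha\gamma:\gamma\in Q_0\}$. -}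

module Defs where

open import Level using (Level; _⊔_; Lift)
open import Data.Nat using (ℕ; zero; suc; _≤_; _^_)
open import Data.Nat.Divisibility using (_∣_)
open import Data.Nat.Primality using (Prime)
open import Data.Fin using (Fin)
open import Data.Product using (Σ; ∃; _×_; _,_)
open import Data.Sum using (_⊎_)
open import Relation.Nullary using (¬_)
open import Relation.Binary.PropositionalEquality using (_≡_)
open import Algebra.Bundles using (CommutativeRing)

OddPrimePower : ℕ → Set
OddPrimePower q = Σ ℕ λ p → Σ ℕ λ k → Prime p × ¬ (2 ∣ p) × 1 ≤ k × q ≡ p ^ k

module _ {c ℓ : Level} (R : CommutativeRing c ℓ) where
  open CommutativeRing R

  pow : Carrier → ℕ → Carrier
  pow x zero    = 1#
  pow x (suc n) = x * pow x n

  IsFieldRing : Set (c ⊔ ℓ)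
  IsFieldRing = (¬ (1# ≈ 0#)) × (∀ x → ¬ (x ≈ 0#) → ∃ λ y → x * y ≈ 1#)

  HasSize : (Carrier → Set (c ⊔ ℓ)) → ℕ → Set (c ⊔ ℓ)
  HasSize P n = Σ (Fin n → Carrier) λ f →
      (∀ i → P (f i))
    × (∀ i j → f i ≈ f j → i ≡ j)
    × (∀ x → P x → ∃ λ i → f i ≈ x)

  Everything : Carrier → Set (c ⊔ ℓ)
  Everything x = Lift c (x ≈ x)

  -- membership in the subfield F_q of F_{q^2}: fixed points of Frobenius x ↦ x^q
  InSubfield : ℕ → Carrier → Set ℓ
  InSubfield q x = pow x q ≈ x

  NonSquareInSubfield : ℕ → Carrier → Set (c ⊔ ℓ)
  NonSquareInSubfield q d =
    InSubfield q d × ¬ (d ≈ 0#) × ¬ (∃ λ y → InSubfield q y × y * y ≈ d)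

  Primitive : Carrier → Set (c ⊔ ℓ)
  Primitive β = ¬ (β ≈ 0#) × (∀ x → ¬ (x ≈ 0#) → ∃ λ k → pow β k ≈ x)

  IsMthPower : ℕ → Carrier → Set (c ⊔ ℓ)
  IsMthPower m z = ∃ λ y → ¬ (y ≈ 0#) × pow y m ≈ z

  IsClique : ℕ → (Carrier → Set (c ⊔ ℓ)) → Set (c ⊔ ℓ)
  IsClique m S = ∀ x y → S x → S y → ¬ (x ≈ y) → IsMthPower m (x - y)

  omega : ℕ → Carrier → Carrier
  omega q β = pow β (q Data.Nat.∸ 1)

  -- α Q_0 where Q_0 = ⟨ω^m⟩ = { (ω^m)^k : k ∈ ℕ }
  AlphaQ0 : ℕ → ℕ → Carrier → Carrier → Carrier → Set (c ⊔ ℓ)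
  AlphaQ0 q m α β x = Lift c (∃ λ k → x ≈ α * pow (pow (omega q β) m) k)

  ZeroAlphaQ0 : ℕ → ℕ → Carrier → Carrier → Carrier → Set (c ⊔ ℓ)
  ZeroAlphaQ0 q m α β x = Lift c (x ≈ 0#) ⊎ AlphaQ0 q m α β x

module Submission where

-- Put w = ω^m and s = (q+1)/m, so that αQ₀ = {α wⁱ : i < s} and every u ∈ Q₀ satisfies
-- u^(q+1) = 1, i.e. u^q = u⁻¹. Since α ∉ 𝔽_q, its conjugate is α^q = -α, so the Frobenius
-- x ↦ x^q maps z = αu - αv to -α/u + α/v = z/(uv); hence z^(q-1) = (uv)⁻¹ and z^((q-1)s) = 1.
-- As q² - 1 = (q-1) s m and β generates 𝔽_{q²}^*, such a z is an m-th power. For z = ±αu one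
-- gets z^(q-1) = -u⁻², whose s-th power is 1 when s is even, which is the case when
-- m ∣ (q+1)/2: then 0 can be added to the clique.

open import Defs
open import Level using (Level; Lift; lift; _⊔_)
open import Data.Nat as ℕ
  using (ℕ; zero; suc; _∸_; _!; _%_; _/_; z≤n; s≤s; NonZero; >-nonZero)
import Data.Nat.Properties as ℕ
open import Data.Nat.Divisibility as ∣
  using (_∣_; divides; divides-refl; ∣m∣n⇒∣m+n; ∣-refl)
open import Data.Nat.DivMod using (m≡m%n+[m/n]*n; m%n<n; m*n/n≡m; m/n*n≡m)
open import Data.Nat.Primality using (Prime; euclidsLemma; prime[2]; prime⇒nonZero)
open import Data.Nat.Combinatorics using (_C_; nCn≡1; k![n∸k]!∣n!)
open import Data.Nat.Combinatorics.Specification using (nCk≡n!/k![n-k]!)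
open import Data.Fin as Fin using (Fin; zero; suc; toℕ; fromℕ<; punchIn; punchOut)
import Data.Fin.Properties as Fin
open import Data.Product using (∃; _×_; _,_; proj₁; proj₂)
open import Data.Sum using (_⊎_; inj₁; inj₂; [_,_]; reduce)
open import Function using (_∘_)
open import Relation.Nullary using (¬_; yes; no)
open import Relation.Nullary.Negation using (contradiction)
open import Relation.Binary.Definitions using (Decidable)
open import Relation.Binary.PropositionalEquality as ≡ using (_≡_)
open import Algebra.Bundles using (CommutativeRing)

prime∤! : ∀ {p} → Prime p → ∀ n → n ℕ.< p → ¬ p ∣ n !
prime∤! p-prime zero _ p∣1 with ∣.∣1⇒≡1 p∣1
... | ≡.refl with p-prime
... | ()
prime∤! p-prime (suc n) n<p p∣n! with euclidsLemma (suc n) (n !) p-prime p∣n!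
... | inj₁ p∣1+n = ℕ.<⇒≱ n<p (∣.∣⇒≤ p∣1+n)
... | inj₂ p∣n! = prime∤! p-prime n (ℕ.<-trans (ℕ.n<1+n n) n<p) p∣n!

n∣n! : ∀ n → .{{NonZero n}} → n ∣ n !
n∣n! (suc n) = ∣.m∣m*n (n !)

-- p! = (p C j) · j! · (p ∸ j)! and p divides neither factorial on the right.
prime∣C : ∀ {p} → Prime p → ∀ {j} → 0 ℕ.< j → j ℕ.< p → p ∣ p C j
prime∣C {p} p-prime {j} 0<j j<p
  with euclidsLemma (p C j) (j ! ℕ.* (p ∸ j) !) p-prime p∣product
  where
  instance _ = prime⇒nonZero p-prime
  instance _ = ℕ._!*_!≢0 j (p ∸ j)
  p∣product : p ∣ (p C j) ℕ.* (j ! ℕ.* (p ∸ j) !)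
  p∣product = ≡.subst (p ∣_)
    (≡.sym (≡.trans (≡.cong (ℕ._* (j ! ℕ.* (p ∸ j) !)) (nCk≡n!/k![n-k]! (ℕ.<⇒≤ j<p)))
                    (m/n*n≡m (k![n∸k]!∣n! (ℕ.<⇒≤ j<p)))))
    (n∣n! p)
... | inj₁ p∣C = p∣C
... | inj₂ p∣j!*[p∸j]! with euclidsLemma (j !) ((p ∸ j) !) p-prime p∣j!*[p∸j]!
...   | inj₁ p∣j! = contradiction p∣j! (prime∤! p-prime j j<p)
...   | inj₂ p∣[p∸j]! =
          contradiction p∣[p∸j]! (prime∤! p-prime (p ∸ j) (ℕ.∸-monoʳ-< 0<j (ℕ.<⇒≤ j<p)))

2∣⊎2∣suc : ∀ n → 2 ∣ n ⊎ 2 ∣ suc n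
2∣⊎2∣suc zero = inj₁ (2 ∣.∣0)
2∣⊎2∣suc (suc n) with 2∣⊎2∣suc n
... | inj₁ 2∣n = inj₂ (∣m∣n⇒∣m+n ∣-refl 2∣n)
... | inj₂ 2∣1+n = inj₁ 2∣1+n

2∤⇒2∣suc : ∀ {n} → ¬ 2 ∣ n → 2 ∣ suc n
2∤⇒2∣suc {n} 2∤n with 2∣⊎2∣suc n
... | inj₁ 2∣n = contradiction 2∣n 2∤n
... | inj₂ 2∣1+n = 2∣1+n

2∤⇒2∤^ : ∀ {n} → ¬ 2 ∣ n → ∀ k → ¬ 2 ∣ n ℕ.^ k
2∤⇒2∤^ 2∤n zero 2∣1 with ∣.∣1⇒≡1 2∣1
... | ()
2∤⇒2∤^ {n} 2∤n (suc k) 2∣n^[1+k] =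
  [ 2∤n , 2∤⇒2∤^ 2∤n k ] (euclidsLemma n (n ℕ.^ k) prime[2] 2∣n^[1+k])

oddPrimePower⇒NonZero : ∀ {q} → OddPrimePower q → NonZero q
oddPrimePower⇒NonZero (p , k , p-prime , _ , _ , q≡pᵏ) =
  ≡.subst NonZero (≡.sym q≡pᵏ) (ℕ.m^n≢0 p k {{prime⇒nonZero p-prime}})

oddPrimePower⇒2∣q+1 : ∀ {q} → OddPrimePower q → 2 ∣ q ℕ.+ 1
oddPrimePower⇒2∣q+1 {q} (p , k , _ , 2∤p , _ , q≡pᵏ) = ≡.subst (2 ∣_) (ℕ.+-comm 1 q)
  (2∤⇒2∣suc (≡.subst (λ n → ¬ 2 ∣ n) (≡.sym q≡pᵏ) (2∤⇒2∤^ 2∤p k)))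

m∣n/2⇒2∣n/m : ∀ {n m s} .{{_ : NonZero m}} → n ≡ s ℕ.* m → 2 ∣ n → m ∣ n / 2 → 2 ∣ s
m∣n/2⇒2∣n/m {m = m} {s} n≡sm (divides-refl h) m∣n/2 with ≡.subst (m ∣_) (m*n/n≡m h 2) m∣n/2
... | divides-refl t = divides t (ℕ.*-cancelʳ-≡ s (t ℕ.* 2) m (begin
  s ℕ.* m             ≡⟨ ≡.sym n≡sm ⟩
  t ℕ.* m ℕ.* 2       ≡⟨ ℕ.*-assoc t m 2 ⟩
  t ℕ.* (m ℕ.* 2)     ≡⟨ ≡.cong (t ℕ.*_) (ℕ.*-comm m 2) ⟩
  t ℕ.* (2 ℕ.* m)     ≡⟨ ℕ.*-assoc t 2 m ⟨
  t ℕ.* 2 ℕ.* m       ∎))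
  where open ≡.≡-Reasoning

module Powers {c ℓ : Level} (R : CommutativeRing c ℓ) where
  open CommutativeRing R hiding (zero)
  open import Relation.Binary.Reasoning.Setoid setoid
  open import Algebra.Properties.Ring ring using (-‿distribˡ-*; -‿distribʳ-*; -‿involutive)
  import Algebra.Properties.CommutativeSemiring.Exp commutativeSemiring as Exp
  open import Algebra.Properties.Semiring.Mult semiring using (×1-homo-*) renaming (_×_ to _·_)

  infixr 8 _^_
  _^_ : Carrier → ℕ → Carrier
  _^_ = pow R

  ^≡Exp^ : ∀ x n → x ^ n ≡ x Exp.^ n
  ^≡Exp^ x zero = ≡.refl
  ^≡Exp^ x (suc n) = ≡.cong (x *_) (^≡Exp^ x n)

  ^-congˡ : ∀ n {x y} → x ≈ y → x ^ n ≈ y ^ n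
  ^-congˡ n {x} {y} x≈y rewrite ^≡Exp^ x n | ^≡Exp^ y n = Exp.^-congˡ n x≈y

  ^-congʳ : ∀ x {m n} → m ≡ n → x ^ m ≈ x ^ n
  ^-congʳ x m≡n = reflexive (≡.cong (x ^_) m≡n)

  ^-homo-* : ∀ x m n → x ^ (m ℕ.+ n) ≈ x ^ m * x ^ n
  ^-homo-* x m n rewrite ^≡Exp^ x (m ℕ.+ n) | ^≡Exp^ x m | ^≡Exp^ x n = Exp.^-homo-* x m n

  ^-assocʳ : ∀ x m n → (x ^ m) ^ n ≈ x ^ (m ℕ.* n)
  ^-assocʳ x m n rewrite ^≡Exp^ (x ^ m) n | ^≡Exp^ x m | ^≡Exp^ x (m ℕ.* n) = Exp.^-assocʳ x m n

  ^-distrib-* : ∀ x y n → (x * y) ^ n ≈ x ^ n * y ^ n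
  ^-distrib-* x y n rewrite ^≡Exp^ (x * y) n | ^≡Exp^ x n | ^≡Exp^ y n = Exp.^-distrib-* x y n

  1#^n≈1# : ∀ n → 1# ^ n ≈ 1#
  1#^n≈1# zero = refl
  1#^n≈1# (suc n) = trans (*-identityˡ _) (1#^n≈1# n)

  ^≈1⇒^*≈1 : ∀ {x} n k → x ^ n ≈ 1# → x ^ (n ℕ.* k) ≈ 1#
  ^≈1⇒^*≈1 {x} n k xⁿ≈1 = begin
    x ^ (n ℕ.* k) ≈⟨ ^-assocʳ x n k ⟨
    (x ^ n) ^ k   ≈⟨ ^-congˡ k xⁿ≈1 ⟩
    1# ^ k        ≈⟨ 1#^n≈1# k ⟩
    1#            ∎

  ^≈1⇒^∣≈1 : ∀ {x n k} → n ∣ k → x ^ n ≈ 1# → x ^ k ≈ 1#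
  ^≈1⇒^∣≈1 {x} {n} (divides-refl k) xⁿ≈1 =
    trans (^-congʳ x (ℕ.*-comm k n)) (^≈1⇒^*≈1 n k xⁿ≈1)

  ^≈1⇒^%≈^ : ∀ {x} n .{{_ : NonZero n}} → x ^ n ≈ 1# → ∀ k → x ^ k ≈ x ^ (k % n)
  ^≈1⇒^%≈^ {x} n xⁿ≈1 k = begin
    x ^ k                               ≈⟨ ^-congʳ x (m≡m%n+[m/n]*n k n) ⟩
    x ^ (k % n ℕ.+ (k / n) ℕ.* n)       ≈⟨ ^-homo-* x (k % n) _ ⟩
    x ^ (k % n) * x ^ ((k / n) ℕ.* n)   ≈⟨ *-congˡ (^≈1⇒^∣≈1 (∣.n∣m*n (k / n)) xⁿ≈1) ⟩
    x ^ (k % n) * 1#                    ≈⟨ *-identityʳ _ ⟩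
    x ^ (k % n)                         ∎

  2∣n⇒[-x]^n≈x^n : ∀ x {n} → 2 ∣ n → (- x) ^ n ≈ x ^ n
  2∣n⇒[-x]^n≈x^n x (divides-refl t) = begin
    (- x) ^ (t ℕ.* 2)     ≈⟨ ^-congʳ (- x) (ℕ.*-comm t 2) ⟩
    (- x) ^ (2 ℕ.* t)     ≈⟨ ^-assocʳ (- x) 2 t ⟨
    ((- x) ^ 2) ^ t       ≈⟨ ^-congˡ t (*-congˡ (*-identityʳ (- x))) ⟩
    (- x * - x) ^ t       ≈⟨ ^-congˡ t -x*-x≈x*x ⟩
    (x * x) ^ t           ≈⟨ ^-congˡ t (*-congˡ (*-identityʳ x)) ⟨
    (x ^ 2) ^ t           ≈⟨ ^-assocʳ x 2 t ⟩
    x ^ (2 ℕ.* t)         ≈⟨ ^-congʳ x (ℕ.*-comm 2 t) ⟩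
    x ^ (t ℕ.* 2)         ∎
    where
    -x*-x≈x*x : - x * - x ≈ x * x
    -x*-x≈x*x = begin
      - x * - x       ≈⟨ -‿distribˡ-* x (- x) ⟨
      - (x * - x)     ≈⟨ -‿cong (-‿distribʳ-* x x) ⟨
      - (- (x * x))   ≈⟨ -‿involutive (x * x) ⟩
      x * x           ∎

  ×1-homo-^ : ∀ m n → (m ℕ.^ n) · 1# ≈ (m · 1#) ^ n
  ×1-homo-^ m zero = +-identityʳ 1#
  ×1-homo-^ m (suc n) = trans (×1-homo-* m (m ℕ.^ n)) (*-congˡ (×1-homo-^ m n))

module Field {c ℓ : Level} (F : CommutativeRing c ℓ) (isField : IsFieldRing F) where
  open CommutativeRing F hiding (zero)
  open Powers F
  open import Relation.Binary.Reasoning.Setoid setoid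
  open import Algebra.Properties.Ring ring using (x[y-z]≈xy-xz; x∙y⁻¹≈ε⇒x≈y; -‿involutive)

  1≉0 : 1# ≉ 0#
  1≉0 = proj₁ isField

  *-cancelˡ : ∀ x {a b} → x ≉ 0# → x * a ≈ x * b → a ≈ b
  *-cancelˡ x {a} {b} x≉0 xa≈xb with proj₂ isField x x≉0
  ... | y , xy≈1 = begin
    a             ≈⟨ *-identityˡ a ⟨
    1# * a        ≈⟨ *-congʳ (trans (sym xy≈1) (*-comm x y)) ⟩
    (y * x) * a   ≈⟨ *-assoc y x a ⟩
    y * (x * a)   ≈⟨ *-congˡ xa≈xb ⟩
    y * (x * b)   ≈⟨ *-assoc y x b ⟨
    (y * x) * b   ≈⟨ *-congʳ (trans (*-comm y x) xy≈1) ⟩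
    1# * b        ≈⟨ *-identityˡ b ⟩
    b             ∎

  *-≉0 : ∀ {a b} → a ≉ 0# → b ≉ 0# → a * b ≉ 0#
  *-≉0 {a} a≉0 b≉0 ab≈0 = b≉0 (*-cancelˡ a a≉0 (trans ab≈0 (sym (zeroʳ a))))

  ^-≉0 : ∀ {x} n → x ≉ 0# → x ^ n ≉ 0#
  ^-≉0 zero x≉0 = 1≉0
  ^-≉0 (suc n) x≉0 = *-≉0 x≉0 (^-≉0 n x≉0)

  ^≈^⇒^∸≈1 : ∀ {x a b} → x ≉ 0# → a ℕ.≤ b → x ^ a ≈ x ^ b → x ^ (b ∸ a) ≈ 1#
  ^≈^⇒^∸≈1 {x} {a} {b} x≉0 a≤b xᵃ≈xᵇ = *-cancelˡ (x ^ a) (^-≉0 a x≉0) (begin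
    x ^ a * x ^ (b ∸ a)    ≈⟨ ^-homo-* x a (b ∸ a) ⟨
    x ^ (a ℕ.+ (b ∸ a))    ≈⟨ ^-congʳ x (ℕ.m+[n∸m]≡n a≤b) ⟩
    x ^ b                  ≈⟨ xᵃ≈xᵇ ⟨
    x ^ a                  ≈⟨ *-identityʳ _ ⟨
    x ^ a * 1#             ∎)

  module _ (_≟_ : Decidable _≈_) where

    *≈0⇒≈0⊎≈0 : ∀ {a b} → a * b ≈ 0# → a ≈ 0# ⊎ b ≈ 0#
    *≈0⇒≈0⊎≈0 {a} {b} ab≈0 with a ≟ 0#
    ... | yes a≈0 = inj₁ a≈0
    ... | no a≉0 = inj₂ (*-cancelˡ a a≉0 (trans ab≈0 (sym (zeroʳ a))))

    ^≈0⇒≈0 : ∀ {x} n → x ^ n ≈ 0# → x ≈ 0#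
    ^≈0⇒≈0 {x} n xⁿ≈0 with x ≟ 0#
    ... | yes x≈0 = x≈0
    ... | no x≉0 = contradiction xⁿ≈0 (^-≉0 n x≉0)

    x*x≈1⇒x≈±1 : ∀ {x} → x * x ≈ 1# → x ≈ 1# ⊎ x ≈ - 1#
    x*x≈1⇒x≈±1 {x} xx≈1 with *≈0⇒≈0⊎≈0 [x+1][x-1]≈0
      where
      [x+1][x-1]≈0 : (x + 1#) * (x - 1#) ≈ 0#
      [x+1][x-1]≈0 = begin
        (x + 1#) * (x - 1#)                ≈⟨ x[y-z]≈xy-xz (x + 1#) x 1# ⟩
        (x + 1#) * x - (x + 1#) * 1#       ≈⟨ +-cong (distribʳ x x 1#) (-‿cong (*-identityʳ _)) ⟩
        (x * x + 1# * x) - (x + 1#)        ≈⟨ +-congʳ (+-cong xx≈1 (*-identityˡ x)) ⟩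
        (1# + x) - (x + 1#)                ≈⟨ +-congʳ (+-comm 1# x) ⟩
        (x + 1#) - (x + 1#)                ≈⟨ -‿inverseʳ _ ⟩
        0#                                 ∎
    ... | inj₁ x+1≈0 = inj₂ (x∙y⁻¹≈ε⇒x≈y x (- 1#) (trans (+-congˡ (-‿involutive 1#)) x+1≈0))
    ... | inj₂ x-1≈0 = inj₁ (x∙y⁻¹≈ε⇒x≈y x 1# x-1≈0)

module FiniteRing {c ℓ : Level} (R : CommutativeRing c ℓ) {N : ℕ}
    (size : HasSize R (Everything R) N) where
  open CommutativeRing R hiding (zero)
  open import Relation.Binary.Reasoning.Setoid setoid
  open import Algebra.Properties.Ring ring using (+-cancelˡ)
  open import Algebra.Properties.Semiring.Mult semiring using () renaming (_×_ to _·_)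
  open import Algebra.Properties.CommutativeMonoid.Sum +-commutativeMonoid
    using (sum; sum-permute; sum-cong-≋; ∑-distrib-+; sum-replicate)
  open import Data.Fin.Permutation using (Permutation; permutation; _⟨$⟩ʳ_)

  enum : Fin N → Carrier
  enum = proj₁ size

  enum-injective : ∀ i j → enum i ≈ enum j → i ≡ j
  enum-injective = proj₁ (proj₂ (proj₂ size))

  index : Carrier → Fin N
  index x = proj₁ (proj₂ (proj₂ (proj₂ size)) x (lift refl))

  enum-index : ∀ x → enum (index x) ≈ x
  enum-index x = proj₂ (proj₂ (proj₂ (proj₂ size)) x (lift refl))

  index-cong : ∀ {x y} → x ≈ y → index x ≡ index y
  index-cong {x} {y} x≈y = enum-injective _ _ (trans (enum-index x) (trans x≈y (sym (enum-index y))))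

  index-enum : ∀ i → index (enum i) ≡ i
  index-enum i = enum-injective _ _ (enum-index (enum i))

  index-injective : ∀ {x y} → index x ≡ index y → x ≈ y
  index-injective {x} {y} ix≡iy =
    trans (sym (enum-index x)) (trans (reflexive (≡.cong enum ix≡iy)) (enum-index y))

  _≟_ : Decidable _≈_
  x ≟ y with index x Fin.≟ index y
  ... | yes ix≡iy = yes (index-injective ix≡iy)
  ... | no ix≢iy = no (ix≢iy ∘ index-cong)

  -- Translation by 1# permutes the elements, so Σ x = Σ (x + 1) = Σ x + N · 1#.
  N·1#≈0# : N · 1# ≈ 0#
  N·1#≈0# = +-cancelˡ (sum enum) (N · 1#) 0# (begin
    sum enum + N · 1#                    ≈⟨ +-congˡ (sum-replicate N) ⟨
    sum enum + sum {N} (λ _ → 1#)        ≈⟨ ∑-distrib-+ enum (λ _ → 1#) ⟨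
    sum {N} (λ i → enum i + 1#)          ≈⟨ sum-cong-≋ (λ i → enum-index (enum i + 1#)) ⟨
    sum {N} (λ i → enum (shift ⟨$⟩ʳ i))  ≈⟨ sum-permute enum shift ⟨
    sum enum                             ≈⟨ +-identityʳ _ ⟨
    sum enum + 0#                        ∎)
    where
    translate : Carrier → Fin N → Fin N
    translate a i = index (enum i + a)

    translate-cancel : ∀ {a b} → b + a ≈ 0# → ∀ i → translate a (translate b i) ≡ i
    translate-cancel {a} {b} b+a≈0 i = ≡.trans (index-cong (begin
      enum (index (enum i + b)) + a   ≈⟨ +-congʳ (enum-index _) ⟩
      (enum i + b) + a                ≈⟨ +-assoc _ _ _ ⟩
      enum i + (b + a)                ≈⟨ +-congˡ b+a≈0 ⟩
      enum i + 0#                     ≈⟨ +-identityʳ _ ⟩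
      enum i                          ∎)) (index-enum i)

    shift : Permutation N N
    shift = permutation (translate 1#) (translate (- 1#))
      (translate-cancel (-‿inverseˡ 1#)) (translate-cancel (-‿inverseʳ 1#))

module Frobenius {c ℓ : Level} (R : CommutativeRing c ℓ) where
  open CommutativeRing R hiding (zero)
  open Powers R
  open import Relation.Binary.Reasoning.Setoid setoid
  open import Algebra.Properties.Semiring.Mult semiring
    using (×1-homo-*; ×-assoc-*; ×-congʳ) renaming (_×_ to _·_)
  open import Algebra.Properties.Monoid.Sum +-monoid
    using (sum; sum-init-last; sum-cong-≋; sum-replicate-zero)
  import Algebra.Properties.CommutativeSemiring.Binomial commutativeSemiring as Binomial
  import Algebra.Properties.CommutativeSemiring.Exp commutativeSemiring as Exp

  ∣n⇒n·x≈0 : ∀ {p n} → p · 1# ≈ 0# → p ∣ n → ∀ x → n · x ≈ 0#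
  ∣n⇒n·x≈0 {p} p·1≈0 (divides-refl t) x = begin
    (t ℕ.* p) · x               ≈⟨ ×-congʳ (t ℕ.* p) (*-identityˡ x) ⟨
    (t ℕ.* p) · (1# * x)        ≈⟨ ×-assoc-* (t ℕ.* p) 1# x ⟨
    ((t ℕ.* p) · 1#) * x        ≈⟨ *-congʳ (×1-homo-* t p) ⟩
    ((t · 1#) * (p · 1#)) * x   ≈⟨ *-congʳ (*-congˡ p·1≈0) ⟩
    ((t · 1#) * 0#) * x         ≈⟨ *-congʳ (zeroʳ _) ⟩
    0# * x                      ≈⟨ zeroˡ x ⟩
    0#                          ∎

  -- All interior binomial coefficients p C j are divisible by p, hence vanish.
  frobenius : ∀ {p} → Prime p → p · 1# ≈ 0# → ∀ x y → (x + y) ^ p ≈ x ^ p + y ^ p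
  frobenius {suc p′} p-prime p·1≈0 x y = begin
    (x + y) ^ p                                      ≡⟨ ^≡Exp^ (x + y) p ⟩
    (x + y) Exp.^ p                                  ≈⟨ Binomial.theorem p x y ⟩
    T zero + sum (T ∘ suc)                           ≈⟨ +-congˡ (sum-init-last (T ∘ suc)) ⟩
    T zero + (sum (T ∘ suc ∘ Fin.inject₁) + T top)   ≈⟨ +-congˡ (+-congʳ interior≈0) ⟩
    T zero + (0# + T top)                            ≈⟨ +-congˡ (+-identityˡ _) ⟩
    T zero + T top                                   ≈⟨ +-cong first last ⟩
    y ^ p + x ^ p                                    ≈⟨ +-comm _ _ ⟩
    x ^ p + y ^ p                                    ∎
    where
    p = suc p′
    T = Binomial.binomialTerm x y p
    top = suc (Fin.fromℕ p′)

    interior≈0 : sum (T ∘ suc ∘ Fin.inject₁) ≈ 0#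
    interior≈0 = trans
      (sum-cong-≋ λ i → ∣n⇒n·x≈0 p·1≈0 (prime∣C p-prime (s≤s z≤n) (s≤s (Fin.inject₁ℕ< i))) _)
      (sum-replicate-zero p′)

    first : T zero ≈ y ^ p
    first = begin
      T zero             ≈⟨ +-identityʳ _ ⟩
      1# * y Exp.^ p     ≈⟨ *-identityˡ _ ⟩
      y Exp.^ p          ≡⟨ ^≡Exp^ y p ⟨
      y ^ p              ∎

    last : T top ≈ x ^ p
    last = begin
      T top                                   ≡⟨ ≡.cong (λ k → (p C k) · (x Exp.^ k * y Exp.^ (p ∸ k)))
                                                        (≡.cong suc (Fin.toℕ-fromℕ p′)) ⟩
      (p C p) · (x Exp.^ p * y Exp.^ (p ∸ p)) ≡⟨ ≡.cong₂ (λ n k → n · (x Exp.^ p * y Exp.^ k))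
                                                         (nCn≡1 p) (ℕ.n∸n≡0 p) ⟩
      1 · (x Exp.^ p * 1#)                    ≈⟨ +-identityʳ _ ⟩
      x Exp.^ p * 1#                          ≈⟨ *-identityʳ _ ⟩
      x Exp.^ p                               ≡⟨ ^≡Exp^ x p ⟨
      x ^ p                                   ∎

  frobenius-^ : ∀ {p} → Prime p → p · 1# ≈ 0# →
    ∀ k x y → (x + y) ^ (p ℕ.^ k) ≈ x ^ (p ℕ.^ k) + y ^ (p ℕ.^ k)
  frobenius-^ p-prime p·1≈0 zero x y =
    trans (*-identityʳ _) (+-cong (sym (*-identityʳ x)) (sym (*-identityʳ y)))
  frobenius-^ {p} p-prime p·1≈0 (suc k) x y = begin
    (x + y) ^ (p ℕ.* pᵏ)                  ≈⟨ ^-assocʳ (x + y) p pᵏ ⟨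
    ((x + y) ^ p) ^ pᵏ                    ≈⟨ ^-congˡ pᵏ (frobenius p-prime p·1≈0 x y) ⟩
    (x ^ p + y ^ p) ^ pᵏ                  ≈⟨ frobenius-^ p-prime p·1≈0 k (x ^ p) (y ^ p) ⟩
    (x ^ p) ^ pᵏ + (y ^ p) ^ pᵏ           ≈⟨ +-cong (^-assocʳ x p pᵏ) (^-assocʳ y p pᵏ) ⟩
    x ^ (p ℕ.* pᵏ) + y ^ (p ℕ.* pᵏ)       ∎
    where pᵏ = p ℕ.^ k

module CyclicUnits {c ℓ : Level} (F : CommutativeRing c ℓ) (isField : IsFieldRing F)
    {M : ℕ} (size : HasSize F (Everything F) (suc M))
    {β : CommutativeRing.Carrier F} (β-primitive : Primitive F β) where
  open CommutativeRing F hiding (zero)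
  open Powers F
  open Field F isField
  open FiniteRing F size
  open import Relation.Binary.Reasoning.Setoid setoid

  β≉0 : β ≉ 0#
  β≉0 = proj₁ β-primitive

  log : ∀ x → x ≉ 0# → ℕ
  log x x≉0 = proj₁ (proj₂ β-primitive x x≉0)

  β^log : ∀ x x≉0 → β ^ log x x≉0 ≈ x
  β^log x x≉0 = proj₂ (proj₂ β-primitive x x≉0)

  unit : Fin M → Carrier
  unit i = enum (punchIn (index 0#) i)

  unit≉0 : ∀ i → unit i ≉ 0#
  unit≉0 i unit≈0 = Fin.punchInᵢ≢i (index 0#) i
    (≡.trans (≡.sym (index-enum _)) (index-cong unit≈0))

  unit-injective : ∀ i j → unit i ≈ unit j → i ≡ j
  unit-injective i j uᵢ≈uⱼ = Fin.punchIn-injective (index 0#) i j (enum-injective _ _ uᵢ≈uⱼ)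

  unitIndex : ∀ x → x ≉ 0# → Fin M
  unitIndex x x≉0 = punchOut (x≉0 ∘ sym ∘ index-injective)

  unit-unitIndex : ∀ x x≉0 → unit (unitIndex x x≉0) ≈ x
  unit-unitIndex x x≉0 =
    trans (reflexive (≡.cong enum (Fin.punchIn-punchOut _))) (enum-index x)

  -- Every unit is β^k for some k < r, so the M units inject into Fin r.
  β^r≈1⇒M≤r : ∀ r .{{_ : NonZero r}} → β ^ r ≈ 1# → M ℕ.≤ r
  β^r≈1⇒M≤r r βʳ≈1 = Fin.injective⇒≤ {f = reducedLog} reducedLog-injective
    where
    reducedLog : Fin M → Fin r
    reducedLog i = fromℕ< (m%n<n (log (unit i) (unit≉0 i)) r)

    β^reducedLog : ∀ i → β ^ toℕ (reducedLog i) ≈ unit i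
    β^reducedLog i = begin
      β ^ toℕ (reducedLog i)              ≡⟨ ≡.cong (β ^_) (Fin.toℕ-fromℕ< (m%n<n logᵢ r)) ⟩
      β ^ (logᵢ % r)                        ≈⟨ ^≈1⇒^%≈^ r βʳ≈1 logᵢ ⟨
      β ^ logᵢ                              ≈⟨ β^log _ _ ⟩
      unit i                              ∎
      where logᵢ = log (unit i) (unit≉0 i)

    reducedLog-injective : ∀ {i j} → reducedLog i ≡ reducedLog j → i ≡ j
    reducedLog-injective {i} {j} same = unit-injective i j (begin
      unit i                    ≈⟨ β^reducedLog i ⟨
      β ^ toℕ (reducedLog i)    ≡⟨ ≡.cong (λ k → β ^ toℕ k) same ⟩
      β ^ toℕ (reducedLog j)    ≈⟨ β^reducedLog j ⟩
      unit j                    ∎)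

  powerIndex : Fin (suc M) → Fin M
  powerIndex i = unitIndex (β ^ toℕ i) (^-≉0 (toℕ i) β≉0)

  -- Pigeonhole: two of β⁰, …, β^M are the same unit.
  β^e≈1 : ∃ λ e → 0 ℕ.< e × e ℕ.≤ M × β ^ e ≈ 1#
  β^e≈1 with Fin.pigeonhole (ℕ.n<1+n M) powerIndex
  ... | i , j , i<j , same =
    toℕ j ∸ toℕ i , ℕ.m<n⇒0<n∸m i<j ,
    ℕ.≤-trans (ℕ.m∸n≤m (toℕ j) (toℕ i)) (ℕ.s≤s⁻¹ (Fin.toℕ<n j)) ,
    ^≈^⇒^∸≈1 β≉0 (ℕ.<⇒≤ i<j) (begin
      β ^ toℕ i              ≈⟨ unit-unitIndex _ (^-≉0 (toℕ i) β≉0) ⟨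
      unit (powerIndex i)    ≡⟨ ≡.cong unit same ⟩
      unit (powerIndex j)    ≈⟨ unit-unitIndex _ (^-≉0 (toℕ j) β≉0) ⟩
      β ^ toℕ j              ∎)

  0<M : 0 ℕ.< M
  0<M with β^e≈1
  ... | e , 0<e , e≤M , _ = ℕ.<-≤-trans 0<e e≤M

  instance
    M≢0 : NonZero M
    M≢0 = >-nonZero 0<M

  β^M≈1 : β ^ M ≈ 1#
  β^M≈1 with β^e≈1
  ... | e , 0<e , e≤M , βᵉ≈1 =
    trans (^-congʳ β (ℕ.≤-antisym (β^r≈1⇒M≤r e {{>-nonZero 0<e}} βᵉ≈1) e≤M)) βᵉ≈1

  β^r≈1⇒M∣r : ∀ r → β ^ r ≈ 1# → M ∣ r
  β^r≈1⇒M∣r r βʳ≈1 = ∣.m%n≡0⇒n∣m r M (r%M≡0 (r % M) ≡.refl)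
    where
    r%M≡0 : ∀ k → r % M ≡ k → r % M ≡ 0
    r%M≡0 zero r%M≡k = r%M≡k
    r%M≡0 (suc k) r%M≡k = contradiction (β^r≈1⇒M≤r (suc k) βᵏ⁺¹≈1)
      (ℕ.<⇒≱ (≡.subst (ℕ._< M) r%M≡k (m%n<n r M)))
      where
      βᵏ⁺¹≈1 : β ^ suc k ≈ 1#
      βᵏ⁺¹≈1 = trans (^-congʳ β (≡.sym r%M≡k)) (trans (sym (^≈1⇒^%≈^ M β^M≈1 r)) βʳ≈1)

  β^-injective-≤ : ∀ {a b} → a ℕ.≤ b → b ℕ.< M → β ^ a ≈ β ^ b → a ≡ b
  β^-injective-≤ {a} {b} a≤b b<M βᵃ≈βᵇ with b ∸ a in b∸a≡d
  ... | zero = ℕ.≤-antisym a≤b (ℕ.m∸n≡0⇒m≤n b∸a≡d)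
  ... | suc d = contradiction (β^r≈1⇒M≤r (suc d) βᵈ⁺¹≈1)
      (ℕ.<⇒≱ (ℕ.≤-<-trans (≡.subst (ℕ._≤ b) b∸a≡d (ℕ.m∸n≤m b a)) b<M))
    where
    βᵈ⁺¹≈1 : β ^ suc d ≈ 1#
    βᵈ⁺¹≈1 = trans (^-congʳ β (≡.sym b∸a≡d)) (^≈^⇒^∸≈1 β≉0 a≤b βᵃ≈βᵇ)

  β^-injective : ∀ {a b} → a ℕ.< M → b ℕ.< M → β ^ a ≈ β ^ b → a ≡ b
  β^-injective {a} {b} a<M b<M βᵃ≈βᵇ with ℕ.≤-total a b
  ... | inj₁ a≤b = β^-injective-≤ a≤b b<M βᵃ≈βᵇ
  ... | inj₂ b≤a = ≡.sym (β^-injective-≤ b≤a a<M (sym βᵃ≈βᵇ))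

  ^≈1⇒mthPower : ∀ {m t x} → t ℕ.* m ≡ M → x ≉ 0# → x ^ t ≈ 1# → IsMthPower F m x
  ^≈1⇒mthPower {m} {t} {x} tm≡M x≉0 xᵗ≈1 = β ^ k , ^-≉0 k β≉0 , (begin
    (β ^ k) ^ m     ≈⟨ ^-assocʳ β k m ⟩
    β ^ (k ℕ.* m)   ≡⟨ ≡.cong (β ^_) (≡.sym (∣._∣_.equality m∣a)) ⟩
    β ^ a           ≈⟨ β^log x x≉0 ⟩
    x               ∎)
    where
    a = log x x≉0
    instance
      t≢0 : NonZero t
      t≢0 = ℕ.m*n≢0⇒m≢0 t {{≡.subst NonZero (≡.sym tm≡M) M≢0}}
    M∣at : M ∣ a ℕ.* t
    M∣at = β^r≈1⇒M∣r (a ℕ.* t) (begin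
      β ^ (a ℕ.* t)   ≈⟨ ^-assocʳ β a t ⟨
      (β ^ a) ^ t     ≈⟨ ^-congˡ t (β^log x x≉0) ⟩
      x ^ t           ≈⟨ xᵗ≈1 ⟩
      1#              ∎)
    m∣a : m ∣ a
    m∣a = ∣.*-cancelʳ-∣ t (≡.subst (_∣ a ℕ.* t) (≡.trans (≡.sym tm≡M) (ℕ.*-comm t m)) M∣at)
    k = ∣.quotient m∣a

module PaleyGraph {c ℓ : Level} (F : CommutativeRing c ℓ) where
  open CommutativeRing F hiding (zero)
  open import Algebra.Properties.Ring ring using (-0#≈0#)

  With0 : (Carrier → Set (c ⊔ ℓ)) → Carrier → Set (c ⊔ ℓ)
  With0 P x = Lift c (x ≈ 0#) ⊎ P x

  mthPower-cong : ∀ {m a b} → a ≈ b → IsMthPower F m a → IsMthPower F m b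
  mthPower-cong a≈b (y , y≉0 , yᵐ≈a) = y , y≉0 , trans yᵐ≈a a≈b

  With0-hasSize : ∀ {P n} → HasSize F P n → (∀ x → P x → x ≉ 0#) → HasSize F (With0 P) (suc n)
  With0-hasSize {P} {n} (f , f∈P , f-injective , f-surjective) P≉0 = g , g∈ , g-injective , g-surjective
    where
    g : Fin (suc n) → Carrier
    g zero = 0#
    g (suc i) = f i

    g∈ : ∀ i → With0 P (g i)
    g∈ zero = inj₁ (lift refl)
    g∈ (suc i) = inj₂ (f∈P i)

    g-injective : ∀ i j → g i ≈ g j → i ≡ j
    g-injective zero zero _ = ≡.refl
    g-injective zero (suc j) 0≈fⱼ = contradiction (sym 0≈fⱼ) (P≉0 _ (f∈P j))
    g-injective (suc i) zero fᵢ≈0 = contradiction fᵢ≈0 (P≉0 _ (f∈P i))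
    g-injective (suc i) (suc j) fᵢ≈fⱼ = ≡.cong suc (f-injective i j fᵢ≈fⱼ)

    g-surjective : ∀ x → With0 P x → ∃ λ i → g i ≈ x
    g-surjective x (inj₁ (lift x≈0)) = zero , sym x≈0
    g-surjective x (inj₂ x∈P) with f-surjective x x∈P
    ... | i , fᵢ≈x = suc i , fᵢ≈x

  With0-isClique : ∀ {m P} → IsClique F m P →
    (∀ x → P x → IsMthPower F m x) → (∀ x → P x → IsMthPower F m (- x)) →
    IsClique F m (With0 P)
  With0-isClique clique mth -mth x y (inj₁ (lift x≈0)) (inj₁ (lift y≈0)) x≉y =
    contradiction (trans x≈0 (sym y≈0)) x≉y
  With0-isClique {m} clique mth -mth x y (inj₁ (lift x≈0)) (inj₂ y∈P) x≉y =
    mthPower-cong {m} (trans (sym (+-identityˡ (- y))) (+-congʳ (sym x≈0))) (-mth y y∈P)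
  With0-isClique {m} clique mth -mth x y (inj₂ x∈P) (inj₁ (lift y≈0)) x≉y =
    mthPower-cong {m} (trans (sym (+-identityʳ x)) (+-congˡ (trans (sym -0#≈0#) (-‿cong (sym y≈0))))) (mth x x∈P)
  With0-isClique clique mth -mth x y (inj₂ x∈P) (inj₂ y∈P) x≉y = clique x y x∈P y∈P x≉y

module QuadraticExtension {c ℓ : Level} (F : CommutativeRing c ℓ) (isField : IsFieldRing F)
    {q₁ : ℕ} (size : HasSize F (Everything F) (suc q₁ ℕ.* suc q₁))
    {p k : ℕ} (p-prime : Prime p) (q≡pᵏ : suc q₁ ≡ p ℕ.^ k) where
  open CommutativeRing F hiding (zero)
  open Powers F
  open Field F isField
  open FiniteRing F size
  open Frobenius F
  open PaleyGraph F
  open import Relation.Binary.Reasoning.Setoid setoid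
  open import Algebra.Properties.Ring ring
    using (-‿distribˡ-*; -‿distribʳ-*; -‿involutive; -0#≈0#; +-inverseˡ-unique; [y-z]x≈yx-zx; x∙y⁻¹≈ε⇒x≈y)
  open import Algebra.Properties.Semiring.Mult semiring using (×1-homo-*) renaming (_×_ to _·_)

  q : ℕ
  q = suc q₁

  p·1#≈0# : p · 1# ≈ 0#
  p·1#≈0# = ^≈0⇒≈0 _≟_ k (begin
    (p · 1#) ^ k      ≈⟨ ×1-homo-^ p k ⟨
    (p ℕ.^ k) · 1#    ≡⟨ ≡.cong (_· 1#) (≡.sym q≡pᵏ) ⟩
    q · 1#            ≈⟨ reduce (*≈0⇒≈0⊎≈0 _≟_ (trans (sym (×1-homo-* q q)) N·1#≈0#)) ⟩
    0#                ∎)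

  ^q-homo-+ : ∀ x y → (x + y) ^ q ≈ x ^ q + y ^ q
  ^q-homo-+ x y = begin
    (x + y) ^ q                     ≡⟨ ≡.cong ((x + y) ^_) q≡pᵏ ⟩
    (x + y) ^ (p ℕ.^ k)             ≈⟨ frobenius-^ p-prime p·1#≈0# k x y ⟩
    x ^ (p ℕ.^ k) + y ^ (p ℕ.^ k)   ≡⟨ ≡.cong (λ n → x ^ n + y ^ n) q≡pᵏ ⟨
    x ^ q + y ^ q                   ∎

  ^q-homo-neg : ∀ x → (- x) ^ q ≈ - x ^ q
  ^q-homo-neg x = +-inverseˡ-unique _ _ (begin
    (- x) ^ q + x ^ q   ≈⟨ ^q-homo-+ (- x) x ⟨
    (- x + x) ^ q       ≈⟨ ^-congˡ q (-‿inverseˡ x) ⟩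
    0# ^ q              ≈⟨ zeroˡ _ ⟩
    0#                  ∎)

  ^q-homo-sub : ∀ x y → (x - y) ^ q ≈ x ^ q - y ^ q
  ^q-homo-sub x y = trans (^q-homo-+ x (- y)) (+-congˡ (^q-homo-neg y))

  module SquareRoot {d : Carrier} (d-nonsquare : NonSquareInSubfield F q d)
           {α : Carrier} (α*α≈d : α * α ≈ d) where

    α≉0 : α ≉ 0#
    α≉0 α≈0 = proj₁ (proj₂ d-nonsquare) (trans (sym α*α≈d) (trans (*-congʳ α≈0) (zeroˡ α)))

    -- (α^q₁)² = d^q₁ = 1, and α^q₁ = 1 would put the square root α of d into 𝔽_q.
    α^q≈-α : α ^ q ≈ - α
    α^q≈-α with x*x≈1⇒x≈±1 _≟_ α^q₁*α^q₁≈1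
      where
      d^q₁≈1 : d ^ q₁ ≈ 1#
      d^q₁≈1 = *-cancelˡ d (proj₁ (proj₂ d-nonsquare)) (trans (proj₁ d-nonsquare) (sym (*-identityʳ d)))

      α^q₁*α^q₁≈1 : α ^ q₁ * α ^ q₁ ≈ 1#
      α^q₁*α^q₁≈1 = trans (sym (^-distrib-* α α q₁)) (trans (^-congˡ q₁ α*α≈d) d^q₁≈1)
    ... | inj₁ α^q₁≈1 = contradiction (α , trans (*-congˡ α^q₁≈1) (*-identityʳ α) , α*α≈d)
                                      (proj₂ (proj₂ d-nonsquare))
    ... | inj₂ α^q₁≈-1 = begin
      α * α ^ q₁    ≈⟨ *-congˡ α^q₁≈-1 ⟩
      α * - 1#      ≈⟨ -‿distribʳ-* α 1# ⟨
      - (α * 1#)    ≈⟨ -‿cong (*-identityʳ α) ⟩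
      - α           ∎

    module Q₀ {β : Carrier} (β-primitive : Primitive F β)
             {m s : ℕ} (sm≡q+1 : s ℕ.* m ≡ q ℕ.+ 1) where
      open CyclicUnits F isField size β-primitive

      q₁sm≡q²-1 : q₁ ℕ.* s ℕ.* m ≡ q₁ ℕ.+ q₁ ℕ.* q
      q₁sm≡q²-1 = ≡.trans (ℕ.*-assoc q₁ s m)
        (≡.trans (≡.cong (q₁ ℕ.*_) (≡.trans sm≡q+1 (ℕ.+-comm q 1))) (ℕ.*-suc q₁ q))

      u^s≈1⇒u^q*u≈1 : ∀ {u} → u ^ s ≈ 1# → u ^ q * u ≈ 1#
      u^s≈1⇒u^q*u≈1 {u} uˢ≈1 = begin
        u ^ q * u          ≈⟨ *-congˡ (*-identityʳ u) ⟨
        u ^ q * u ^ 1      ≈⟨ ^-homo-* u q 1 ⟨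
        u ^ (q ℕ.+ 1)      ≡⟨ ≡.cong (u ^_) sm≡q+1 ⟨
        u ^ (s ℕ.* m)      ≈⟨ ^≈1⇒^*≈1 s m uˢ≈1 ⟩
        1#                 ∎

      -- z^q c = z forces (z^(q-1))^s = c^(-s) = 1, and (q-1) s m = q² - 1.
      twisted⇒mthPower : ∀ {z c} → z ≉ 0# → z ^ q * c ≈ z → c ^ s ≈ 1# → IsMthPower F m z
      twisted⇒mthPower {z} {c} z≉0 zᵠc≈z cˢ≈1 = ^≈1⇒mthPower {m} {q₁ ℕ.* s} q₁sm≡q²-1 z≉0 (begin
        z ^ (q₁ ℕ.* s)           ≈⟨ ^-assocʳ z q₁ s ⟨
        (z ^ q₁) ^ s             ≈⟨ *-identityʳ _ ⟨
        (z ^ q₁) ^ s * 1#        ≈⟨ *-congˡ cˢ≈1 ⟨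
        (z ^ q₁) ^ s * c ^ s     ≈⟨ ^-distrib-* _ _ s ⟨
        (z ^ q₁ * c) ^ s         ≈⟨ ^-congˡ s zᵠ⁻¹c≈1 ⟩
        1# ^ s                   ≈⟨ 1#^n≈1# s ⟩
        1#                       ∎)
        where
        zᵠ⁻¹c≈1 : z ^ q₁ * c ≈ 1#
        zᵠ⁻¹c≈1 = *-cancelˡ z z≉0 (trans (sym (*-assoc z (z ^ q₁) c)) (trans zᵠc≈z (sym (*-identityʳ z))))

      twisted-neg : ∀ {z c} → z ^ q * c ≈ z → (- z) ^ q * c ≈ - z
      twisted-neg {z} {c} zᵠc≈z = begin
        (- z) ^ q * c     ≈⟨ *-congʳ (^q-homo-neg z) ⟩
        - z ^ q * c       ≈⟨ -‿distribˡ-* _ _ ⟨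
        - (z ^ q * c)     ≈⟨ -‿cong zᵠc≈z ⟩
        - z               ∎

      [αu]^q*u≈-α : ∀ {u} → u ^ s ≈ 1# → (α * u) ^ q * u ≈ - α
      [αu]^q*u≈-α {u} uˢ≈1 = begin
        (α * u) ^ q * u        ≈⟨ *-congʳ (^-distrib-* α u q) ⟩
        (α ^ q * u ^ q) * u    ≈⟨ *-assoc _ _ _ ⟩
        α ^ q * (u ^ q * u)    ≈⟨ *-cong α^q≈-α (u^s≈1⇒u^q*u≈1 uˢ≈1) ⟩
        - α * 1#               ≈⟨ *-identityʳ _ ⟩
        - α                    ∎

      αu-twisted : ∀ {u} → u ^ s ≈ 1# → (α * u) ^ q * (- (u * u)) ≈ α * u
      αu-twisted {u} uˢ≈1 = begin
        (α * u) ^ q * (- (u * u))   ≈⟨ -‿distribʳ-* _ _ ⟨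
        - ((α * u) ^ q * (u * u))   ≈⟨ -‿cong (*-assoc _ u u) ⟨
        - ((α * u) ^ q * u * u)     ≈⟨ -‿cong (*-congʳ ([αu]^q*u≈-α uˢ≈1)) ⟩
        - (- α * u)                 ≈⟨ -‿cong (-‿distribˡ-* α u) ⟨
        - (- (α * u))               ≈⟨ -‿involutive _ ⟩
        α * u                       ∎

      αu-αv-twisted : ∀ {u v} → u ^ s ≈ 1# → v ^ s ≈ 1# →
        (α * u - α * v) ^ q * (u * v) ≈ α * u - α * v
      αu-αv-twisted {u} {v} uˢ≈1 vˢ≈1 = begin
        (α * u - α * v) ^ q * (u * v)                   ≈⟨ *-congʳ (^q-homo-sub _ _) ⟩
        ((α * u) ^ q - (α * v) ^ q) * (u * v)           ≈⟨ [y-z]x≈yx-zx (u * v) _ _ ⟩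
        (α * u) ^ q * (u * v) - (α * v) ^ q * (u * v)   ≈⟨ +-cong ([αu]^q*uv≈-αv uˢ≈1) (-‿cong [αv]^q*uv≈-αu) ⟩
        - α * v - - α * u                               ≈⟨ +-cong (-‿distribˡ-* α v) (-‿cong (-‿distribˡ-* α u)) ⟨
        - (α * v) - - (α * u)                           ≈⟨ +-congˡ (-‿involutive _) ⟩
        - (α * v) + α * u                               ≈⟨ +-comm _ _ ⟩
        α * u - α * v                                   ∎
        where
        [αu]^q*uv≈-αv : ∀ {u v} → u ^ s ≈ 1# → (α * u) ^ q * (u * v) ≈ - α * v
        [αu]^q*uv≈-αv {u} {v} uˢ≈1 = trans (sym (*-assoc _ u v)) (*-congʳ ([αu]^q*u≈-α uˢ≈1))

        [αv]^q*uv≈-αu : (α * v) ^ q * (u * v) ≈ - α * u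
        [αv]^q*uv≈-αu = trans (*-congˡ (*-comm u v)) ([αu]^q*uv≈-αv vˢ≈1)

      w : Carrier
      w = pow F (omega F q β) m

      w^n≈β^ : ∀ n → w ^ n ≈ β ^ (q₁ ℕ.* m ℕ.* n)
      w^n≈β^ n = begin
        ((β ^ q₁) ^ m) ^ n       ≈⟨ ^-congˡ n (^-assocʳ β q₁ m) ⟩
        (β ^ (q₁ ℕ.* m)) ^ n     ≈⟨ ^-assocʳ β (q₁ ℕ.* m) n ⟩
        β ^ (q₁ ℕ.* m ℕ.* n)     ∎

      q₁ms≡q²-1 : q₁ ℕ.* m ℕ.* s ≡ q₁ ℕ.+ q₁ ℕ.* q
      q₁ms≡q²-1 = ≡.trans (ℕ.*-assoc q₁ m s) (≡.trans (≡.cong (q₁ ℕ.*_) (ℕ.*-comm m s))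
                    (≡.trans (≡.sym (ℕ.*-assoc q₁ s m)) q₁sm≡q²-1))

      w^s≈1 : w ^ s ≈ 1#
      w^s≈1 = trans (w^n≈β^ s) (trans (^-congʳ β q₁ms≡q²-1) β^M≈1)

      [w^i]^s≈1 : ∀ i → (w ^ i) ^ s ≈ 1#
      [w^i]^s≈1 i = trans (^-assocʳ w i s) (^≈1⇒^∣≈1 (∣.n∣m*n i) w^s≈1)

      w^-injective : ∀ {a b} → a ℕ.< s → b ℕ.< s → w ^ a ≈ w ^ b → a ≡ b
      w^-injective {a} {b} a<s b<s wᵃ≈wᵇ = ℕ.*-cancelˡ-≡ a b (q₁ ℕ.* m)
        (β^-injective (scaled< a<s) (scaled< b<s) (trans (sym (w^n≈β^ a)) (trans wᵃ≈wᵇ (w^n≈β^ b))))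
        where
        instance
          q₁m≢0 : NonZero (q₁ ℕ.* m)
          q₁m≢0 = ℕ.m*n≢0⇒m≢0 (q₁ ℕ.* m) {{≡.subst NonZero (≡.sym q₁ms≡q²-1) M≢0}}
        scaled< : ∀ {a} → a ℕ.< s → q₁ ℕ.* m ℕ.* a ℕ.< q₁ ℕ.+ q₁ ℕ.* q
        scaled< {a} a<s = ≡.subst (q₁ ℕ.* m ℕ.* a ℕ.<_) q₁ms≡q²-1 (ℕ.*-monoʳ-< (q₁ ℕ.* m) a<s)

      αQ₀ : Carrier → Set (c ⊔ ℓ)
      αQ₀ = AlphaQ0 F q m α β

      αw^i≉0 : ∀ i → α * w ^ i ≉ 0#
      αw^i≉0 i = *-≉0 α≉0 (^-≉0 i (^-≉0 m (^-≉0 q₁ β≉0)))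

      αQ₀-≉0 : ∀ x → αQ₀ x → x ≉ 0#
      αQ₀-≉0 x (lift (i , x≈αwⁱ)) x≈0 = αw^i≉0 i (trans (sym x≈αwⁱ) x≈0)

      αQ₀-hasSize : HasSize F αQ₀ s
      αQ₀-hasSize = f , (λ i → lift (toℕ i , refl)) , f-injective , f-surjective
        where
        instance
          s≢0 : NonZero s
          s≢0 = ℕ.m*n≢0⇒m≢0 s {{≡.subst NonZero (≡.sym sm≡q+1) _}}

        f : Fin s → Carrier
        f i = α * w ^ toℕ i

        f-injective : ∀ i j → f i ≈ f j → i ≡ j
        f-injective i j fᵢ≈fⱼ = Fin.toℕ-injective
          (w^-injective (Fin.toℕ<n i) (Fin.toℕ<n j) (*-cancelˡ α α≉0 fᵢ≈fⱼ))

        f-surjective : ∀ x → αQ₀ x → ∃ λ i → f i ≈ x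
        f-surjective x (lift (n , x≈αwⁿ)) = fromℕ< (m%n<n n s) , (begin
          α * w ^ toℕ (fromℕ< (m%n<n n s))   ≡⟨ ≡.cong (λ e → α * w ^ e) (Fin.toℕ-fromℕ< (m%n<n n s)) ⟩
          α * w ^ (n % s)                    ≈⟨ *-congˡ (^≈1⇒^%≈^ s w^s≈1 n) ⟨
          α * w ^ n                          ≈⟨ x≈αwⁿ ⟨
          x                                  ∎)

      αQ₀-isClique : IsClique F m αQ₀
      αQ₀-isClique x y (lift (i , x≈αwⁱ)) (lift (j , y≈αwʲ)) x≉y =
        mthPower-cong {m} (sym x-y≈z) (twisted⇒mthPower z≉0
          (αu-αv-twisted ([w^i]^s≈1 i) ([w^i]^s≈1 j)) cˢ≈1)
        where
        x-y≈z : x - y ≈ α * w ^ i - α * w ^ j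
        x-y≈z = +-cong x≈αwⁱ (-‿cong y≈αwʲ)
        z≉0 : α * w ^ i - α * w ^ j ≉ 0#
        z≉0 z≈0 = x≉y (x∙y⁻¹≈ε⇒x≈y x y (trans x-y≈z z≈0))
        cˢ≈1 : (w ^ i * w ^ j) ^ s ≈ 1#
        cˢ≈1 = trans (^-distrib-* _ _ s) (trans (*-cong ([w^i]^s≈1 i) ([w^i]^s≈1 j)) (*-identityʳ 1#))

      module _ (2∣s : 2 ∣ s) where

        [-uu]^s≈1 : ∀ {u} → u ^ s ≈ 1# → (- (u * u)) ^ s ≈ 1#
        [-uu]^s≈1 {u} uˢ≈1 = begin
          (- (u * u)) ^ s    ≈⟨ 2∣n⇒[-x]^n≈x^n (u * u) 2∣s ⟩
          (u * u) ^ s        ≈⟨ ^-distrib-* u u s ⟩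
          u ^ s * u ^ s      ≈⟨ *-cong uˢ≈1 uˢ≈1 ⟩
          1# * 1#            ≈⟨ *-identityʳ 1# ⟩
          1#                 ∎

        αQ₀-mthPower : ∀ x → αQ₀ x → IsMthPower F m x
        αQ₀-mthPower x (lift (i , x≈αwⁱ)) = mthPower-cong {m} (sym x≈αwⁱ)
          (twisted⇒mthPower (αw^i≉0 i) (αu-twisted ([w^i]^s≈1 i)) ([-uu]^s≈1 ([w^i]^s≈1 i)))

        αQ₀-neg-mthPower : ∀ x → αQ₀ x → IsMthPower F m (- x)
        αQ₀-neg-mthPower x (lift (i , x≈αwⁱ)) = mthPower-cong {m} (-‿cong (sym x≈αwⁱ))
          (twisted⇒mthPower -αwⁱ≉0 (twisted-neg (αu-twisted ([w^i]^s≈1 i))) ([-uu]^s≈1 ([w^i]^s≈1 i)))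
          where
          -αwⁱ≉0 : - (α * w ^ i) ≉ 0#
          -αwⁱ≉0 -αwⁱ≈0 = αw^i≉0 i (trans (sym (-‿involutive _)) (trans (-‿cong -αwⁱ≈0) -0#≈0#))

open import Data.Nat using (_+_; _*_; _≤_)

proposition4p13 : {c ℓ : Level} (q : ℕ) → OddPrimePower q →
    (m : ℕ) → .{{_ : NonZero m}} → 2 ≤ m → m ∣ (q + 1) →
    (F : CommutativeRing c ℓ) → IsFieldRing F → HasSize F (Everything F) (q * q) →
    (d : CommutativeRing.Carrier F) → NonSquareInSubfield F q d →
    (α : CommutativeRing.Carrier F) → CommutativeRing._≈_ F (CommutativeRing._*_ F α α) d →
    (β : CommutativeRing.Carrier F) → Primitive F β →
    ((¬ (m ∣ ((q + 1) / 2))) →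
        IsClique F m (AlphaQ0 F q m α β) × HasSize F (AlphaQ0 F q m α β) ((q + 1) / m))
    × ((m ∣ ((q + 1) / 2)) →
        IsClique F m (ZeroAlphaQ0 F q m α β) × HasSize F (ZeroAlphaQ0 F q m α β) ((q + 1 + m) / m))
proposition4p13 zero q-odd = contradiction ≡.refl (ℕ.≢-nonZero⁻¹ 0 {{oddPrimePower⇒NonZero q-odd}})
proposition4p13 q@(suc q₁) q-odd@(p , k , p-prime , _ , _ , q≡pᵏ) m _ (divides s q+1≡sm)
                F isField size d d-nonsquare α α*α≈d β β-primitive =
    (λ _ → αQ₀-isClique , ≡.subst (HasSize F αQ₀) (≡.sym [q+1]/m≡s) αQ₀-hasSize)
  , (λ m∣[q+1]/2 → let 2∣s = m∣n/2⇒2∣n/m q+1≡sm (oddPrimePower⇒2∣q+1 q-odd) m∣[q+1]/2 in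
        With0-isClique {m} αQ₀-isClique (αQ₀-mthPower 2∣s) (αQ₀-neg-mthPower 2∣s)
      , ≡.subst (HasSize F (With0 αQ₀)) (≡.sym [q+1+m]/m≡1+s) (With0-hasSize αQ₀-hasSize αQ₀-≉0))
  where
  open PaleyGraph F
  open QuadraticExtension.SquareRoot.Q₀ F isField size {k = k} p-prime q≡pᵏ d-nonsquare α*α≈d
    β-primitive {m} {s} (≡.sym q+1≡sm)

  [q+1]/m≡s : (q + 1) / m ≡ s
  [q+1]/m≡s = ≡.trans (≡.cong (_/ m) q+1≡sm) (m*n/n≡m s m)

  [q+1+m]/m≡1+s : (q + 1 + m) / m ≡ suc s
  [q+1+m]/m≡1+s = ≡.trans (≡.cong (λ n → (n + m) / m) q+1≡sm)
    (≡.trans (≡.cong (_/ m) (ℕ.+-comm (s * m) m)) (m*n/n≡m (suc s) m))
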